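{- Let $r$ be a positive integer. For integers $n>r$ define $$\Delta(n,r)=\det\left[\frac{\Gamma(2n+1)}{\Gamma\big(2(j-i+n)+1\big)}\right]_{i,j=1}^{r},\qquad g(i,n)=(2n+2i)(2n+2i-1),$$ and $$\overline{\Delta}(n,r)=\frac{1}{(2n)^{r(r-1)}}\left(\prod_{i=1}^{r-1}g(i,n)^{r-i}\right)\Delta(n,r).$$ Then there is a polynomial $P(y)=\sum_{i=0}^{r(r-1)}\delta(i)y^i$ of degree $r(r-1)$, independent of $n$, such that $\overline{\Delta}(n,r)=P(1/(2n))$ for all integers $n>r$, and its coefficients satisfy $\delta(i)=0$ for $i=0,1,\ldots,r(r-1)/2-1$. -}

module Defs where

open import Data.Nat as ℕ using (ℕ; zero; suc; _!; _∸_)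
open import Data.Nat.Properties using (_!≢0)
open import Data.Fin using (Fin; zero; suc; toℕ; punchIn)
open import Data.Integer as ℤ using (ℤ)
open import Data.Rational using (ℚ; 0ℚ; 1ℚ; _+_; _*_; -_; _/_)

_^ℚ_ : ℚ → ℕ → ℚ
y ^ℚ zero  = 1ℚ
y ^ℚ suc k = y * (y ^ℚ k)

sumℕ : ℕ → (ℕ → ℚ) → ℚ
sumℕ zero    f = 0ℚ
sumℕ (suc m) f = sumℕ m f + f m

sumFin : ∀ {m} → (Fin m → ℚ) → ℚ
sumFin {zero}  f = 0ℚ
sumFin {suc m} f = f zero + sumFin (λ j → f (suc j))

sign : ℕ → ℚ
sign zero          = 1ℚ
sign (suc zero)    = - 1ℚ
sign (suc (suc k)) = sign k

det : ∀ m → (Fin m → Fin m → ℚ) → ℚ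
det zero    A = 1ℚ
det (suc m) A =
  sumFin (λ j → sign (toℕ j) * (A zero j *
    det m (λ i k → A (suc i) (punchIn j k))))

-- Γ(2n+1)/Γ(2(j-i+n)+1) = (2n)! / (2(n+j-i))!  (indices i,j ∈ {1..r}
-- shifted to Fin r = {0..r-1}; n > r so n + j - i ≥ 1 and ∸ is exact).
entry : ℕ → ∀ {r} → Fin r → Fin r → ℚ
entry n i j =
  let k = 2 ℕ.* ((n ℕ.+ toℕ j) ∸ toℕ i) in
  _/_ (ℤ.+ ((2 ℕ.* n) !)) (k !) {{k !≢0}}

Δ : ℕ → ℕ → ℚ
Δ n r = det r (entry n)

g : ℕ → ℕ → ℕ
g i n = (2 ℕ.* n ℕ.+ 2 ℕ.* i) ℕ.* (2 ℕ.* n ℕ.+ 2 ℕ.* i ∸ 1)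

prodG : ℕ → ℕ → ℕ → ℕ
prodG zero    n r = 1
prodG (suc m) n r = prodG m n r ℕ.* (g (suc m) n ℕ.^ (r ∸ suc m))

-- 1/(2n)  (n = 0 never used: n > r ≥ 1)
inv2n : ℕ → ℚ
inv2n zero    = 0ℚ
inv2n (suc m) = ℤ.+ 1 / (2 ℕ.* suc m)

Δbar : ℕ → ℕ → ℚ
Δbar n r =
  (inv2n n ^ℚ (r ℕ.* (r ∸ 1))) * ((ℤ.+ prodG (r ∸ 1) n r / 1) * Δ n r)

evalPoly : (ℕ → ℚ) → ℕ → ℚ → ℚ
evalPoly δ d y = sumℕ (suc d) (λ i → δ i * (y ^ℚ i))

{-# OPTIONS --safe #-}
-- Write hᵢ = r − 1 − i.  Multiplying row i by ∏_{t ≤ hᵢ} g(t, n) (these factors multiply to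
-- ∏ g(i, n)^{r−i}) turns entry (i, j) into the falling factorial (M + 2hᵢ)^{(2hⱼ)}, M = 2n: the value of
-- the polynomial x^{(2hⱼ)} at M + 2hᵢ.  Subtracting suitable neighbouring rows replaces row i by the
-- hᵢ-th backward difference (step 2) of these polynomials, so entry (i, j) becomes a polynomial in M of
-- degree at most 2hⱼ − hᵢ and the determinant a polynomial Q(M) of degree at most Σ hᵢ = r(r−1)/2.
-- Hence Δ̄ = M^{−r(r−1)} Q(M) is a polynomial of degree r(r−1) in 1/M whose coefficients below r(r−1)/2
-- vanish; its top coefficient Q(0) is the determinant of the upper triangular matrix ((2hᵢ)^{(2hⱼ)})
-- with diagonal (2hᵢ)!, hence non-zero.
module Submission where

open import Defs

module NatEmbedding where
  open import Data.Nat as ℕ using (ℕ; suc; _∸_; NonZero)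
  import Data.Nat.Properties as ℕ
  open import Data.Integer as ℤ using ()
  import Data.Integer.Properties as ℤ
  open import Data.Rational using (ℚ; 0ℚ; _+_; _*_; _-_; _/_; toℚᵘ; fromℚᵘ)
  open import Data.Rational.Properties
    using (toℚᵘ-injective; toℚᵘ-fromℚᵘ; toℚᵘ-homo-*; toℚᵘ-homo-+; fromℚᵘ-cong; +-assoc; +-inverseʳ; +-identityʳ)
  open import Data.Rational.Unnormalised as ℚᵘ using (ℚᵘ; mkℚᵘ; *≡*)
  import Data.Rational.Unnormalised.Properties as ℚᵘ
  open import Relation.Binary.PropositionalEquality
  open ≡-Reasoning

  fromℕ : ℕ → ℚ
  fromℕ a = ℤ.+ a / 1

  fromℚᵘ-* : ∀ p q → fromℚᵘ p * fromℚᵘ q ≡ fromℚᵘ (p ℚᵘ.* q)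
  fromℚᵘ-* p q = toℚᵘ-injective (ℚᵘ.≃-trans (toℚᵘ-homo-* (fromℚᵘ p) (fromℚᵘ q))
    (ℚᵘ.≃-trans (ℚᵘ.*-cong (toℚᵘ-fromℚᵘ p) (toℚᵘ-fromℚᵘ q)) (ℚᵘ.≃-sym (toℚᵘ-fromℚᵘ (p ℚᵘ.* q)))))

  fromℚᵘ-+ : ∀ p q → fromℚᵘ p + fromℚᵘ q ≡ fromℚᵘ (p ℚᵘ.+ q)
  fromℚᵘ-+ p q = toℚᵘ-injective (ℚᵘ.≃-trans (toℚᵘ-homo-+ (fromℚᵘ p) (fromℚᵘ q))
    (ℚᵘ.≃-trans (ℚᵘ.+-cong (toℚᵘ-fromℚᵘ p) (toℚᵘ-fromℚᵘ q)) (ℚᵘ.≃-sym (toℚᵘ-fromℚᵘ (p ℚᵘ.+ q)))))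

  -- ℤ.+ a / suc b  is definitionally  fromℚᵘ (mkℚᵘ (ℤ.+ a) b).
  fraction-* : ∀ a b c d e f → a ℕ.* c ℕ.* suc f ≡ e ℕ.* (suc b ℕ.* suc d) →
               (ℤ.+ a / suc b) * (ℤ.+ c / suc d) ≡ ℤ.+ e / suc f
  fraction-* a b c d e f eq = trans (fromℚᵘ-* (mkℚᵘ (ℤ.+ a) b) (mkℚᵘ (ℤ.+ c) d))
    (fromℚᵘ-cong {mkℚᵘ (ℤ.+ a) b ℚᵘ.* mkℚᵘ (ℤ.+ c) d} {mkℚᵘ (ℤ.+ e) f} (*≡* (begin
      ℤ.+ a ℤ.* ℤ.+ c ℤ.* ℤ.+ suc f     ≡⟨ cong (ℤ._* ℤ.+ suc f) (ℤ.pos-* a c) ⟨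
      ℤ.+ (a ℕ.* c) ℤ.* ℤ.+ suc f       ≡⟨ ℤ.pos-* (a ℕ.* c) (suc f) ⟨
      ℤ.+ (a ℕ.* c ℕ.* suc f)           ≡⟨ cong ℤ.+_ eq ⟩
      ℤ.+ (e ℕ.* (suc b ℕ.* suc d))     ≡⟨ ℤ.pos-* e _ ⟩
      ℤ.+ e ℤ.* ℤ.+ (suc b ℕ.* suc d)   ∎)))

  fromℕ-* : ∀ a c → fromℕ (a ℕ.* c) ≡ fromℕ a * fromℕ c
  fromℕ-* a c = sym (fraction-* a 0 c 0 (a ℕ.* c) 0 refl)

  fromℕ-+ : ∀ a c → fromℕ (a ℕ.+ c) ≡ fromℕ a + fromℕ c
  fromℕ-+ a c = sym (trans (fromℚᵘ-+ (mkℚᵘ (ℤ.+ a) 0) (mkℚᵘ (ℤ.+ c) 0))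
    (fromℚᵘ-cong {mkℚᵘ (ℤ.+ a) 0 ℚᵘ.+ mkℚᵘ (ℤ.+ c) 0} {mkℚᵘ (ℤ.+ (a ℕ.+ c)) 0} (*≡* (begin
      (ℤ.+ a ℤ.* ℤ.+ 1 ℤ.+ ℤ.+ c ℤ.* ℤ.+ 1) ℤ.* ℤ.+ 1  ≡⟨ ℤ.*-identityʳ _ ⟩
      ℤ.+ a ℤ.* ℤ.+ 1 ℤ.+ ℤ.+ c ℤ.* ℤ.+ 1             ≡⟨ cong₂ ℤ._+_ (ℤ.*-identityʳ (ℤ.+ a)) (ℤ.*-identityʳ (ℤ.+ c)) ⟩
      ℤ.+ a ℤ.+ ℤ.+ c                                 ≡⟨ ℤ.pos-+ a c ⟨
      ℤ.+ (a ℕ.+ c)                                   ≡⟨ ℤ.*-identityʳ _ ⟨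
      ℤ.+ (a ℕ.+ c) ℤ.* ℤ.+ 1                         ∎))))

  fromℕ-∸ : ∀ a c → c ℕ.≤ a → fromℕ (a ∸ c) ≡ fromℕ a - fromℕ c
  fromℕ-∸ a c c≤a = begin
    fromℕ (a ∸ c)                          ≡⟨ +-identityʳ _ ⟨
    fromℕ (a ∸ c) + 0ℚ                     ≡⟨ cong (fromℕ (a ∸ c) +_) (+-inverseʳ (fromℕ c)) ⟨
    fromℕ (a ∸ c) + (fromℕ c - fromℕ c)    ≡⟨ +-assoc (fromℕ (a ∸ c)) (fromℕ c) _ ⟨
    (fromℕ (a ∸ c) + fromℕ c) - fromℕ c    ≡⟨ cong (_- fromℕ c) (fromℕ-+ (a ∸ c) c) ⟨
    fromℕ (a ∸ c ℕ.+ c) - fromℕ c          ≡⟨ cong (λ x → fromℕ x - fromℕ c) (ℕ.m∸n+n≡m c≤a) ⟩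
    fromℕ a - fromℕ c                      ∎

  a/b*c≡d : ∀ a b .{{_ : NonZero b}} c d → a ℕ.* c ≡ d ℕ.* b → (ℤ.+ a / b) * fromℕ c ≡ fromℕ d
  a/b*c≡d a (suc b) c d eq =
    fraction-* a b c 0 d 0 (trans (ℕ.*-identityʳ _) (trans eq (cong (d ℕ.*_) (sym (ℕ.*-identityʳ (suc b))))))

  fromℕ≢0 : ∀ a .{{_ : NonZero a}} → fromℕ a ≢ 0ℚ
  fromℕ≢0 (suc a) eq with ℚᵘ.≃-trans (ℚᵘ.≃-sym (toℚᵘ-fromℚᵘ (mkℚᵘ (ℤ.+ suc a) 0))) (ℚᵘ.≃-reflexive (cong toℚᵘ eq))
  ... | *≡* ()

module Determinant where
  open import Data.Nat as ℕ using (ℕ; zero; suc)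
  import Data.Nat.Properties as ℕ
  open import Data.Fin as Fin using (Fin; zero; suc; toℕ; punchIn; punchOut; inject₁)
  import Data.Fin.Properties as Fin
  open import Data.Vec.Functional using (updateAt)
  open import Data.Vec.Functional.Properties using (updateAt-updates; updateAt-minimal)
  open import Data.Rational using (ℚ; 0ℚ; 1ℚ; _+_; _*_; -_; _-_)
  open import Data.Rational.Properties
    using (+-*-commutativeRing; *-1-monoid; *-zeroˡ; *-zeroʳ; *-identityˡ; +-identityʳ; +-inverseʳ; +-assoc)
  open import Algebra.Bundles using (CommutativeRing)
  open import Algebra.Properties.Semiring.Sum (CommutativeRing.semiring +-*-commutativeRing)
  open import Algebra.Properties.Monoid.Sum *-1-monoid using () renaming (sum to product)
  open import Data.Rational.Solver using (module +-*-Solver)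
  open +-*-Solver
  open import Function using (_∘_)
  open import Relation.Nullary using (Dec; yes; no; contradiction)
  open import Relation.Binary.PropositionalEquality
  open ≡-Reasoning

  Matrix : ℕ → Set
  Matrix m = Fin m → Fin m → ℚ

  minor : ∀ {X : Set} {m} → (Fin (suc m) → Fin (suc m) → X) → Fin (suc m) → Fin m → Fin m → X
  minor A j i k = A (suc i) (punchIn j k)

  laplaceTerm : ∀ {m} → Matrix (suc m) → Fin (suc m) → ℚ
  laplaceTerm {m} A j = sign (toℕ j) * (A zero j * det m (minor A j))

  sumFin≡sum : ∀ {m} (f : Fin m → ℚ) → sumFin f ≡ sum f
  sumFin≡sum {zero}  f = refl
  sumFin≡sum {suc m} f = cong (f zero +_) (sumFin≡sum (f ∘ suc))

  det-expand : ∀ {m} (A : Matrix (suc m)) → det (suc m) A ≡ sum (laplaceTerm A)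
  det-expand A = sumFin≡sum (laplaceTerm A)

  sum-zero : ∀ {m} (f : Fin m → ℚ) → (∀ j → f j ≡ 0ℚ) → sum f ≡ 0ℚ
  sum-zero {m} f f≡0 = trans (sum-cong-≗ f≡0) (sum-replicate-zero m)

  laplaceTerm-entry≡0 : ∀ {m} (A : Matrix (suc m)) j → A zero j ≡ 0ℚ → laplaceTerm A j ≡ 0ℚ
  laplaceTerm-entry≡0 {m} A j a≡0 =
    trans (cong (λ a → sign (toℕ j) * (a * det m (minor A j))) a≡0)
          (trans (cong (sign (toℕ j) *_) (*-zeroˡ (det m (minor A j)))) (*-zeroʳ (sign (toℕ j))))

  laplaceTerm-minor≡0 : ∀ {m} (A : Matrix (suc m)) j → det m (minor A j) ≡ 0ℚ → laplaceTerm A j ≡ 0ℚ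
  laplaceTerm-minor≡0 A j d≡0 =
    trans (cong (λ d → sign (toℕ j) * (A zero j * d)) d≡0)
          (trans (cong (sign (toℕ j) *_) (*-zeroʳ (A zero j))) (*-zeroʳ (sign (toℕ j))))

  det-cong : ∀ {m} {A B : Matrix m} → (∀ i j → A i j ≡ B i j) → det m A ≡ det m B
  det-cong {zero}  A≡B = refl
  det-cong {suc m} {A} {B} A≡B = begin
    det (suc m) A        ≡⟨ det-expand A ⟩
    sum (laplaceTerm A)  ≡⟨ sum-cong-≗ (λ j → cong₂ (λ a d → sign (toℕ j) * (a * d))
                              (A≡B zero j) (det-cong (λ i k → A≡B (suc i) (punchIn j k)))) ⟩
    sum (laplaceTerm B)  ≡⟨ det-expand B ⟨
    det (suc m) B        ∎

  det-row-+ : ∀ {m} (i : Fin m) {A B C : Matrix m} →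
              (∀ k → k ≢ i → B k ≗ A k) → (∀ k → k ≢ i → C k ≗ A k) →
              (∀ j → A i j ≡ B i j + C i j) → det m A ≡ det m B + det m C
  det-row-+ {suc m} i {A} {B} {C} B≗A C≗A Aᵢ≡Bᵢ+Cᵢ = begin
    det (suc m) A                              ≡⟨ det-expand A ⟩
    sum (laplaceTerm A)                        ≡⟨ sum-cong-≗ (terms i B≗A C≗A Aᵢ≡Bᵢ+Cᵢ) ⟩
    sum (λ j → laplaceTerm B j + laplaceTerm C j) ≡⟨ ∑-distrib-+ (laplaceTerm B) (laplaceTerm C) ⟩
    sum (laplaceTerm B) + sum (laplaceTerm C)  ≡⟨ cong₂ _+_ (det-expand B) (det-expand C) ⟨
    det (suc m) B + det (suc m) C              ∎
    where
    terms : ∀ i → (∀ k → k ≢ i → B k ≗ A k) → (∀ k → k ≢ i → C k ≗ A k) →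
            (∀ j → A i j ≡ B i j + C i j) → ∀ j → laplaceTerm A j ≡ laplaceTerm B j + laplaceTerm C j
    terms zero B≗A C≗A A₀≡B₀+C₀ j = begin
      sign (toℕ j) * (A zero j * det m (minor A j))
        ≡⟨ cong (λ a → sign (toℕ j) * (a * det m (minor A j))) (A₀≡B₀+C₀ j) ⟩
      sign (toℕ j) * ((B zero j + C zero j) * det m (minor A j))
        ≡⟨ solve 4 (λ s b c d → s :* ((b :+ c) :* d) := s :* (b :* d) :+ s :* (c :* d)) refl
             (sign (toℕ j)) (B zero j) (C zero j) (det m (minor A j)) ⟩
      sign (toℕ j) * (B zero j * det m (minor A j)) + sign (toℕ j) * (C zero j * det m (minor A j))
        ≡⟨ cong₂ (λ d d′ → sign (toℕ j) * (B zero j * d) + sign (toℕ j) * (C zero j * d′))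
             (det-cong (λ i k → sym (B≗A (suc i) (λ ()) (punchIn j k))))
             (det-cong (λ i k → sym (C≗A (suc i) (λ ()) (punchIn j k)))) ⟩
      laplaceTerm B j + laplaceTerm C j  ∎
    terms (suc i) B≗A C≗A Aᵢ≡Bᵢ+Cᵢ j = begin
      sign (toℕ j) * (A zero j * det m (minor A j))
        ≡⟨ cong (λ d → sign (toℕ j) * (A zero j * d))
             (det-row-+ i (λ k k≢i → B≗A (suc k) (k≢i ∘ Fin.suc-injective) ∘ punchIn j)
                          (λ k k≢i → C≗A (suc k) (k≢i ∘ Fin.suc-injective) ∘ punchIn j)
                          (Aᵢ≡Bᵢ+Cᵢ ∘ punchIn j)) ⟩
      sign (toℕ j) * (A zero j * (det m (minor B j) + det m (minor C j)))
        ≡⟨ solve 4 (λ s a d d′ → s :* (a :* (d :+ d′)) := s :* (a :* d) :+ s :* (a :* d′)) refl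
             (sign (toℕ j)) (A zero j) (det m (minor B j)) (det m (minor C j)) ⟩
      sign (toℕ j) * (A zero j * det m (minor B j)) + sign (toℕ j) * (A zero j * det m (minor C j))
        ≡⟨ cong₂ (λ b c → sign (toℕ j) * (b * det m (minor B j)) + sign (toℕ j) * (c * det m (minor C j)))
             (sym (B≗A zero (λ ()) j)) (sym (C≗A zero (λ ()) j)) ⟩
      laplaceTerm B j + laplaceTerm C j  ∎

  sign-suc : ∀ t → sign (suc t) ≡ - sign t
  sign-suc zero    = refl
  sign-suc (suc t) = sym (trans (cong -_ (sign-suc t)) (solve 1 (λ x → :- (:- x) := x) refl (sign t)))

  punchIn-punchOut-swap : ∀ {k} {j b : Fin (suc (suc k))} (j≢b : j ≢ b) (b≢j : b ≢ j) (l : Fin k) →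
                          punchIn j (punchIn (punchOut j≢b) l) ≡ punchIn b (punchIn (punchOut b≢j) l)
  punchIn-punchOut-swap {j = zero}  {zero}  j≢b b≢j l = contradiction refl j≢b
  punchIn-punchOut-swap {j = zero}  {suc b} j≢b b≢j l = refl
  punchIn-punchOut-swap {j = suc j} {zero}  j≢b b≢j l = refl
  punchIn-punchOut-swap {suc k} {suc j} {suc b} j≢b b≢j zero    = refl
  punchIn-punchOut-swap {suc k} {suc j} {suc b} j≢b b≢j (suc l) =
    cong suc (punchIn-punchOut-swap (j≢b ∘ cong suc) (b≢j ∘ cong suc) l)

  -- The two exponents are  j + b − 1  and  j + b  in some order.
  sign-punchOut : ∀ {k} {j b : Fin (suc (suc k))} (j≢b : j ≢ b) (b≢j : b ≢ j) →
                  sign (toℕ j) * sign (toℕ (punchOut j≢b)) ≡ - (sign (toℕ b) * sign (toℕ (punchOut b≢j)))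
  sign-punchOut {j = zero}  {zero}  j≢b b≢j = contradiction refl j≢b
  sign-punchOut {j = zero}  {suc b} j≢b b≢j rewrite sign-suc (toℕ b) =
    solve 1 (λ x → con 1ℚ :* x := :- ((:- x) :* con 1ℚ)) refl (sign (toℕ b))
  sign-punchOut {j = suc j} {zero}  j≢b b≢j rewrite sign-suc (toℕ j) =
    solve 1 (λ x → (:- x) :* con 1ℚ := :- (con 1ℚ :* x)) refl (sign (toℕ j))
  sign-punchOut {zero}  {suc zero} {suc zero} j≢b b≢j = contradiction refl j≢b
  sign-punchOut {suc k} {suc j}    {suc b}    j≢b b≢j
    rewrite sign-suc (toℕ j) | sign-suc (toℕ b)
          | sign-suc (toℕ (punchOut (j≢b ∘ cong suc))) | sign-suc (toℕ (punchOut (b≢j ∘ cong suc))) =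
    trans (solve 2 (λ x y → (:- x) :* (:- y) := x :* y) refl (sign (toℕ j)) _)
    (trans (sign-punchOut (j≢b ∘ cong suc) (b≢j ∘ cong suc))
           (solve 2 (λ x y → :- (x :* y) := :- ((:- x) :* (:- y))) refl (sign (toℕ b)) _))

  -- The pairs involving index 0 cancel; the others form the same sum one size down.
  sum-punchIn-antisymmetric : ∀ {n} (G : Fin (suc n) → Fin (suc n) → ℚ) → (∀ j b → j ≢ b → G j b ≡ - G b j) →
                              sum (λ j → sum (λ l → G j (punchIn j l))) ≡ 0ℚ
  sum-punchIn-antisymmetric {zero}  G G-antisym = refl
  sum-punchIn-antisymmetric {suc n} G G-antisym = begin
    sum (G zero ∘ suc) + sum (λ j → G (suc j) zero + sum (λ l → G (suc j) (suc (punchIn j l))))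
      ≡⟨ cong (sum (G zero ∘ suc) +_) (∑-distrib-+ (λ j → G (suc j) zero) (λ j → sum (λ l → G (suc j) (suc (punchIn j l))))) ⟩
    sum (G zero ∘ suc) + (sum (λ j → G (suc j) zero) + rest)
      ≡⟨ +-assoc (sum (G zero ∘ suc)) _ rest ⟨
    (sum (G zero ∘ suc) + sum (λ j → G (suc j) zero)) + rest
      ≡⟨ cong₂ _+_ (trans (sym (∑-distrib-+ (G zero ∘ suc) (λ j → G (suc j) zero))) (sum-zero _ pairs-cancel))
                   (sum-punchIn-antisymmetric (λ j b → G (suc j) (suc b)) (λ j b j≢b → G-antisym _ _ (j≢b ∘ Fin.suc-injective))) ⟩
    0ℚ + 0ℚ ∎
    where
    rest : ℚ
    rest = sum (λ j → sum (λ l → G (suc j) (suc (punchIn j l))))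
    pairs-cancel : ∀ j → G zero (suc j) + G (suc j) zero ≡ 0ℚ
    pairs-cancel j = trans (cong (G zero (suc j) +_) (G-antisym (suc j) zero (λ ()))) (+-inverseʳ (G zero (suc j)))

  det-equal-first-rows : ∀ {k} (A : Matrix (suc (suc k))) → A zero ≗ A (suc zero) → det (suc (suc k)) A ≡ 0ℚ
  det-equal-first-rows {k} A A₀≗A₁ = begin
    det (suc (suc k)) A                        ≡⟨ det-expand A ⟩
    sum (laplaceTerm A)                        ≡⟨ sum-cong-≗ expand-row₁ ⟩
    sum (λ j → sum (λ l → G j (punchIn j l)))  ≡⟨ sum-punchIn-antisymmetric G G-antisym ⟩
    0ℚ                                         ∎
    where
    D : Fin (suc (suc k)) → Fin (suc k) → ℚ
    D j l = det k (minor (minor A j) l)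

    -- The term of the expansion along rows 0 and 1 using column j in row 0 and column b = punchIn j l in row 1.
    T : (j b : Fin (suc (suc k))) → Fin (suc k) → ℚ
    T j b l = sign (toℕ j) * (A zero j * (sign (toℕ l) * (A zero b * D j l)))

    G′ : (j b : Fin (suc (suc k))) → Dec (j ≡ b) → ℚ
    G′ j b (yes _)  = 0ℚ
    G′ j b (no j≢b) = T j b (punchOut j≢b)

    G : Fin (suc (suc k)) → Fin (suc (suc k)) → ℚ
    G j b = G′ j b (j Fin.≟ b)

    G-punchIn : ∀ j l → G j (punchIn j l) ≡ T j (punchIn j l) l
    G-punchIn j l with j Fin.≟ punchIn j l
    ... | yes j≡b = contradiction (sym j≡b) (Fin.punchInᵢ≢i j l)
    ... | no j≢b  = cong (T j (punchIn j l)) (trans (Fin.punchOut-cong j refl) (Fin.punchOut-punchIn j))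

    G-antisym : ∀ j b → j ≢ b → G j b ≡ - G b j
    G-antisym j b j≢b with j Fin.≟ b | b Fin.≟ j
    ... | yes j≡b | _       = contradiction j≡b j≢b
    ... | no _    | yes b≡j = contradiction (sym b≡j) j≢b
    ... | no j≢b  | no b≢j  = begin
      sign (toℕ j) * (A zero j * (sign (toℕ l₁) * (A zero b * D j l₁)))
        ≡⟨ solve 5 (λ sj aj sl ab d → sj :* (aj :* (sl :* (ab :* d))) := (sj :* sl) :* (aj :* ab :* d)) refl
             (sign (toℕ j)) (A zero j) (sign (toℕ l₁)) (A zero b) (D j l₁) ⟩
      (sign (toℕ j) * sign (toℕ l₁)) * (A zero j * A zero b * D j l₁)
        ≡⟨ cong₂ (λ s d → s * (A zero j * A zero b * d)) (sign-punchOut j≢b b≢j)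
             (det-cong (λ i l → cong (A (suc (suc i))) (punchIn-punchOut-swap j≢b b≢j l))) ⟩
      - (sign (toℕ b) * sign (toℕ l₂)) * (A zero j * A zero b * D b l₂)
        ≡⟨ solve 5 (λ sb ab sl aj d → (:- (sb :* sl)) :* (aj :* ab :* d) := :- (sb :* (ab :* (sl :* (aj :* d))))) refl
             (sign (toℕ b)) (A zero b) (sign (toℕ l₂)) (A zero j) (D b l₂) ⟩
      - (sign (toℕ b) * (A zero b * (sign (toℕ l₂) * (A zero j * D b l₂)))) ∎
      where
      l₁ l₂ : Fin (suc k)
      l₁ = punchOut j≢b
      l₂ = punchOut b≢j

    expand-row₁ : ∀ j → laplaceTerm A j ≡ sum (λ l → G j (punchIn j l))
    expand-row₁ j = begin
      sign (toℕ j) * (A zero j * det (suc k) (minor A j))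
        ≡⟨ cong (λ d → sign (toℕ j) * (A zero j * d)) (det-expand (minor A j)) ⟩
      sign (toℕ j) * (A zero j * sum (laplaceTerm (minor A j)))
        ≡⟨ cong (sign (toℕ j) *_) (*-distribˡ-sum (A zero j) (laplaceTerm (minor A j))) ⟩
      sign (toℕ j) * sum (λ l → A zero j * laplaceTerm (minor A j) l)
        ≡⟨ *-distribˡ-sum (sign (toℕ j)) (λ l → A zero j * laplaceTerm (minor A j) l) ⟩
      sum (λ l → sign (toℕ j) * (A zero j * laplaceTerm (minor A j) l))
        ≡⟨ sum-cong-≗ (λ l → trans
             (cong (λ a → sign (toℕ j) * (A zero j * (sign (toℕ l) * (a * D j l)))) (sym (A₀≗A₁ (punchIn j l))))
             (sym (G-punchIn j l))) ⟩
      sum (λ l → G j (punchIn j l)) ∎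

  det-equal-adjacent-rows : ∀ {k} (i : Fin (suc k)) (A : Matrix (suc (suc k))) →
                            A (inject₁ i) ≗ A (suc i) → det (suc (suc k)) A ≡ 0ℚ
  det-equal-adjacent-rows zero          A rows≡ = det-equal-first-rows A rows≡
  det-equal-adjacent-rows {suc k} (suc i) A rows≡ = trans (det-expand A) (sum-zero (laplaceTerm A) (λ j →
    laplaceTerm-minor≡0 A j (det-equal-adjacent-rows i (minor A j) (rows≡ ∘ punchIn j))))

  det-subtract-next-row : ∀ {k} (i : Fin (suc k)) (A B : Matrix (suc (suc k))) →
                          (∀ l → l ≢ inject₁ i → B l ≗ A l) →
                          (∀ j → B (inject₁ i) j ≡ A (inject₁ i) j - A (suc i) j) →
                          det (suc (suc k)) B ≡ det (suc (suc k)) A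
  det-subtract-next-row {k} i A B B≗A Bᵢ≡Aᵢ-Aᵢ₊₁ = begin
    det (suc (suc k)) B          ≡⟨ +-identityʳ _ ⟨
    det (suc (suc k)) B + 0ℚ     ≡⟨ cong (det (suc (suc k)) B +_) det-C≡0 ⟨
    det (suc (suc k)) B + det (suc (suc k)) C  ≡⟨ det-row-+ (inject₁ i) B≗A C≗A Aᵢ≡Bᵢ+Cᵢ ⟨
    det (suc (suc k)) A          ∎
    where
    C : Matrix (suc (suc k))
    C = updateAt A (inject₁ i) (λ _ → A (suc i))

    Cᵢ≡Aᵢ₊₁ : C (inject₁ i) ≡ A (suc i)
    Cᵢ≡Aᵢ₊₁ = updateAt-updates (inject₁ i) A

    C≗A : ∀ l → l ≢ inject₁ i → C l ≗ A l
    C≗A l l≢i j = cong-app (updateAt-minimal l (inject₁ i) A l≢i) j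

    suc≢inject₁ : suc i ≢ inject₁ i
    suc≢inject₁ eq = ℕ.1+n≢n (trans (cong toℕ eq) (Fin.toℕ-inject₁ i))

    det-C≡0 : det (suc (suc k)) C ≡ 0ℚ
    det-C≡0 = det-equal-adjacent-rows i C (λ j → trans (cong-app Cᵢ≡Aᵢ₊₁ j) (sym (C≗A (suc i) suc≢inject₁ j)))

    Aᵢ≡Bᵢ+Cᵢ : ∀ j → A (inject₁ i) j ≡ B (inject₁ i) j + C (inject₁ i) j
    Aᵢ≡Bᵢ+Cᵢ j rewrite Bᵢ≡Aᵢ-Aᵢ₊₁ j | cong-app Cᵢ≡Aᵢ₊₁ j =
      solve 2 (λ a b → a := (a :- b) :+ b) refl (A (inject₁ i) j) (A (suc i) j)

  det-scale-rows : ∀ {m} (c : Fin m → ℚ) (A : Matrix m) → det m (λ i j → c i * A i j) ≡ product c * det m A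
  det-scale-rows {zero}  c A = refl
  det-scale-rows {suc m} c A = begin
    det (suc m) cA                                  ≡⟨ det-expand cA ⟩
    sum (laplaceTerm cA)                            ≡⟨ sum-cong-≗ term ⟩
    sum (λ j → product c * laplaceTerm A j)         ≡⟨ *-distribˡ-sum (product c) (laplaceTerm A) ⟨
    product c * sum (laplaceTerm A)                 ≡⟨ cong (product c *_) (det-expand A) ⟨
    product c * det (suc m) A                       ∎
    where
    cA : Matrix (suc m)
    cA i j = c i * A i j

    term : ∀ j → laplaceTerm cA j ≡ product c * laplaceTerm A j
    term j = begin
      sign (toℕ j) * ((c zero * A zero j) * det m (minor cA j))
        ≡⟨ cong (λ d → sign (toℕ j) * ((c zero * A zero j) * d)) (det-scale-rows (c ∘ suc) (minor A j)) ⟩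
      sign (toℕ j) * ((c zero * A zero j) * (product (c ∘ suc) * det m (minor A j)))
        ≡⟨ solve 5 (λ s c₀ a p d → s :* ((c₀ :* a) :* (p :* d)) := (c₀ :* p) :* (s :* (a :* d))) refl
             (sign (toℕ j)) (c zero) (A zero j) (product (c ∘ suc)) (det m (minor A j)) ⟩
      product c * laplaceTerm A j ∎

  laplaceTerm-suc≡0 : ∀ {m} (A : Matrix (suc m)) → (∀ i → A (suc i) zero ≡ 0ℚ) → ∀ j → laplaceTerm A (suc j) ≡ 0ℚ

  det-zero-first-column : ∀ {m} (A : Matrix (suc m)) → (∀ i → A i zero ≡ 0ℚ) → det (suc m) A ≡ 0ℚ
  det-zero-first-column A col≡0 = trans (det-expand A) (sum-zero (laplaceTerm A) term≡0)
    where
    term≡0 : ∀ j → laplaceTerm A j ≡ 0ℚ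
    term≡0 zero    = laplaceTerm-entry≡0 A zero (col≡0 zero)
    term≡0 (suc j) = laplaceTerm-suc≡0 A (col≡0 ∘ suc) j

  laplaceTerm-suc≡0 {suc m} A col≡0 j =
    laplaceTerm-minor≡0 A (suc j) (det-zero-first-column (minor A (suc j)) col≡0)

  det-upper-triangular : ∀ {m} (A : Matrix m) → (∀ i j → toℕ j ℕ.< toℕ i → A i j ≡ 0ℚ) →
                         det m A ≡ product (λ i → A i i)
  det-upper-triangular {zero}  A lower≡0 = refl
  det-upper-triangular {suc m} A lower≡0 = begin
    det (suc m) A
      ≡⟨ det-expand A ⟩
    laplaceTerm A zero + sum (laplaceTerm A ∘ suc)
      ≡⟨ cong₂ _+_ (*-identityˡ (A zero zero * det m (minor A zero))) (sum-zero _ (laplaceTerm-suc≡0 A col≡0)) ⟩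
    A zero zero * det m (minor A zero) + 0ℚ
      ≡⟨ +-identityʳ _ ⟩
    A zero zero * det m (minor A zero)
      ≡⟨ cong (A zero zero *_) (det-upper-triangular (minor A zero) (λ i j j<i → lower≡0 (suc i) (suc j) (ℕ.s≤s j<i))) ⟩
    product (λ i → A i i) ∎
    where
    col≡0 : ∀ i → A (suc i) zero ≡ 0ℚ
    col≡0 i = lower≡0 (suc i) zero (ℕ.s≤s ℕ.z≤n)

module Polynomials where
  open import Data.Nat as ℕ using (ℕ; zero; suc; _∸_)
  import Data.Nat.Properties as ℕ
  open import Data.Fin using (Fin; zero; suc; toℕ; punchIn)
  open import Data.List using (List; []; _∷_)
  open import Data.Rational using (ℚ; 0ℚ; 1ℚ; _+_; _*_; -_; _-_)
  open import Data.Rational.Properties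
    using (+-*-commutativeRing; *-zeroˡ; *-zeroʳ; *-identityʳ; *-distribˡ-+; +-identityˡ; +-identityʳ; +-assoc; +-comm)
  open import Algebra.Bundles using (CommutativeRing)
  open import Algebra.Properties.Semiring.Sum (CommutativeRing.semiring +-*-commutativeRing) using (sum; sum-cong-≗)
  import Algebra.Properties.Semiring.Sum ℕ.+-*-semiring as ℕΣ
  open import Data.Rational.Solver using (module +-*-Solver)
  open +-*-Solver
  open import Function using (_∘_)
  open import Relation.Nullary using (Dec; yes; no)
  open import Relation.Binary.PropositionalEquality
  open Determinant using (minor; det-expand)

  Poly : Set
  Poly = List ℚ

  coeff : Poly → ℕ → ℚ
  coeff []      t       = 0ℚ
  coeff (c ∷ p) zero    = c
  coeff (c ∷ p) (suc t) = coeff p t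

  eval : Poly → ℚ → ℚ
  eval []      x = 0ℚ
  eval (c ∷ p) x = c + x * eval p x

  add : Poly → Poly → Poly
  add []      q       = q
  add (c ∷ p) []      = c ∷ p
  add (c ∷ p) (d ∷ q) = (c + d) ∷ add p q

  scale : ℚ → Poly → Poly
  scale c []      = []
  scale c (d ∷ p) = c * d ∷ scale c p

  mul : Poly → Poly → Poly
  mul []      q = []
  mul (c ∷ p) q = add (scale c q) (0ℚ ∷ mul p q)

  shift : ℚ → Poly → Poly
  shift c []      = []
  shift c (a ∷ p) = add (a ∷ []) (mul (c ∷ 1ℚ ∷ []) (shift c p))

  -- a + x q(x) − (a + (x − c) q(x − c))  =  x (q(x) − q(x − c)) + c q(x − c)
  backDiff : ℚ → Poly → Poly
  backDiff c []      = []
  backDiff c (a ∷ p) = add (0ℚ ∷ backDiff c p) (scale c (shift (- c) p))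

  backDiff^ : ℚ → ℕ → Poly → Poly
  backDiff^ c zero    p = p
  backDiff^ c (suc a) p = backDiff c (backDiff^ c a p)

  eval-add : ∀ p q x → eval (add p q) x ≡ eval p x + eval q x
  eval-add []      q       x = sym (+-identityˡ (eval q x))
  eval-add (c ∷ p) []      x = sym (+-identityʳ _)
  eval-add (c ∷ p) (d ∷ q) x rewrite eval-add p q x =
    solve 5 (λ c d x a b → (c :+ d) :+ x :* (a :+ b) := (c :+ x :* a) :+ (d :+ x :* b)) refl c d x (eval p x) (eval q x)

  eval-scale : ∀ c p x → eval (scale c p) x ≡ c * eval p x
  eval-scale c []      x = sym (*-zeroʳ c)
  eval-scale c (d ∷ p) x rewrite eval-scale c p x =
    solve 4 (λ c d x a → c :* d :+ x :* (c :* a) := c :* (d :+ x :* a)) refl c d x (eval p x)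

  eval-mul : ∀ p q x → eval (mul p q) x ≡ eval p x * eval q x
  eval-mul []      q x = sym (*-zeroˡ (eval q x))
  eval-mul (c ∷ p) q x rewrite eval-add (scale c q) (0ℚ ∷ mul p q) x | eval-scale c q x | eval-mul p q x =
    solve 4 (λ c x a b → c :* b :+ (con 0ℚ :+ x :* (a :* b)) := (c :+ x :* a) :* b) refl c x (eval p x) (eval q x)

  eval-shift : ∀ c p x → eval (shift c p) x ≡ eval p (x + c)
  eval-shift c []      x = refl
  eval-shift c (a ∷ p) x
    rewrite eval-add (a ∷ []) (mul (c ∷ 1ℚ ∷ []) (shift c p)) x | eval-mul (c ∷ 1ℚ ∷ []) (shift c p) x | eval-shift c p x =
    solve 4 (λ a x c e → (a :+ x :* con 0ℚ) :+ (c :+ x :* (con 1ℚ :+ x :* con 0ℚ)) :* e := a :+ (x :+ c) :* e) refl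
      a x c (eval p (x + c))

  eval-backDiff : ∀ c p x → eval (backDiff c p) x ≡ eval p x - eval p (x - c)
  eval-backDiff c []      x = refl
  eval-backDiff c (a ∷ p) x
    rewrite eval-add (0ℚ ∷ backDiff c p) (scale c (shift (- c) p)) x | eval-scale c (shift (- c) p) x
          | eval-shift (- c) p x | eval-backDiff c p x =
    solve 5 (λ a x u v c → (con 0ℚ :+ x :* (u :- v)) :+ c :* v := (a :+ x :* u) :- (a :+ (x :- c) :* v)) refl
      a x (eval p x) (eval p (x - c)) c

  eval-one : ∀ x → eval (1ℚ ∷ []) x ≡ 1ℚ
  eval-one x = solve 1 (λ x → con 1ℚ :+ x :* con 0ℚ := con 1ℚ) refl x

  -- deg p ≤ w − d, the difference taken in ℤ (a negative bound forces p = 0).  Keeping the bound a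
  -- formal difference lets the bounds  w j − d i  of the entries of a matrix add up along a permutation.
  record Degree≤ (p : Poly) (w d : ℕ) : Set where
    constructor degree≤
    field vanishes : ∀ t → w ℕ.< t ℕ.+ d → coeff p t ≡ 0ℚ
  open Degree≤ public

  Degree≤-[] : ∀ {w d} → Degree≤ [] w d
  Degree≤-[] = degree≤ λ _ _ → refl

  Degree≤-const : ∀ c → Degree≤ (c ∷ []) 0 0
  Degree≤-const c = degree≤ λ where (suc t) _ → refl

  Degree≤-linear : ∀ c → Degree≤ (c ∷ 1ℚ ∷ []) 1 0
  Degree≤-linear c = degree≤ λ where
    (suc (suc t)) _ → refl
    (suc zero) (ℕ.s≤s ())

  Degree≤-add : ∀ {p q w d} → Degree≤ p w d → Degree≤ q w d → Degree≤ (add p q) w d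
  Degree≤-add {p} {q} deg-p deg-q = degree≤ λ t lt →
    trans (coeff-add p q t) (cong₂ _+_ (vanishes deg-p t lt) (vanishes deg-q t lt))
    where
    coeff-add : ∀ p q t → coeff (add p q) t ≡ coeff p t + coeff q t
    coeff-add []      q       t       = sym (+-identityˡ _)
    coeff-add (c ∷ p) []      zero    = sym (+-identityʳ _)
    coeff-add (c ∷ p) []      (suc t) = sym (+-identityʳ _)
    coeff-add (c ∷ p) (d ∷ q) zero    = refl
    coeff-add (c ∷ p) (d ∷ q) (suc t) = coeff-add p q t

  Degree≤-scale : ∀ {p w d} c → Degree≤ p w d → Degree≤ (scale c p) w d
  Degree≤-scale {p} c deg-p = degree≤ λ t lt →
    trans (coeff-scale p t) (trans (cong (c *_) (vanishes deg-p t lt)) (*-zeroʳ c))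
    where
    coeff-scale : ∀ p t → coeff (scale c p) t ≡ c * coeff p t
    coeff-scale []      t       = sym (*-zeroʳ c)
    coeff-scale (d ∷ p) zero    = refl
    coeff-scale (d ∷ p) (suc t) = coeff-scale p t

  Degree≤-∷ : ∀ {c p w d} → (w ℕ.< d → c ≡ 0ℚ) → Degree≤ p w (suc d) → Degree≤ (c ∷ p) w d
  Degree≤-∷ {w = w} {d} c≡0 deg-p = degree≤ λ where
    zero    lt → c≡0 lt
    (suc t) lt → vanishes deg-p t (subst (w ℕ.<_) (sym (ℕ.+-suc t d)) lt)

  Degree≤-head : ∀ {c p w d} → Degree≤ (c ∷ p) w d → w ℕ.< d → c ≡ 0ℚ
  Degree≤-head deg = vanishes deg zero

  Degree≤-tail : ∀ {c p w d} → Degree≤ (c ∷ p) w d → Degree≤ p w (suc d)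
  Degree≤-tail {w = w} {d} deg = degree≤ λ t lt → vanishes deg (suc t) (subst (w ℕ.<_) (ℕ.+-suc t d) lt)

  Degree≤-pred : ∀ {p w d} → Degree≤ p (suc w) (suc d) → Degree≤ p w d
  Degree≤-pred {w = w} {d} deg = degree≤ λ t lt → vanishes deg t (subst (suc w ℕ.<_) (sym (ℕ.+-suc t d)) (ℕ.s≤s lt))

  Degree≤-mul : ∀ {p q w₁ w₂ d₁ d₂} → Degree≤ p w₁ d₁ → Degree≤ q w₂ d₂ →
                Degree≤ (mul p q) (w₁ ℕ.+ w₂) (d₁ ℕ.+ d₂)
  Degree≤-mul {[]}    deg-p deg-q = Degree≤-[]
  Degree≤-mul {c ∷ p} {q} {w₁} {w₂} {d₁} {d₂} deg-p deg-q =
    Degree≤-add (Degree≤-scaled-q (w₁ ℕ.<? d₁)) (Degree≤-∷ (λ _ → refl) (Degree≤-mul (Degree≤-tail deg-p) deg-q))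
    where
    -- Either c = 0 (when w₁ < d₁), or the bound of q alone already suffices.
    Degree≤-scaled-q : Dec (w₁ ℕ.< d₁) → Degree≤ (scale c q) (w₁ ℕ.+ w₂) (d₁ ℕ.+ d₂)
    Degree≤-scaled-q (yes w₁<d₁) rewrite Degree≤-head deg-p w₁<d₁ = degree≤ λ t _ → zero-scale q t
      where
      zero-scale : ∀ q t → coeff (scale 0ℚ q) t ≡ 0ℚ
      zero-scale []      t       = refl
      zero-scale (e ∷ q) zero    = *-zeroˡ e
      zero-scale (e ∷ q) (suc t) = zero-scale q t
    Degree≤-scaled-q (no w₁≮d₁) = Degree≤-scale c (degree≤ λ t lt →
      vanishes deg-q t (ℕ.≰⇒> λ t+d₂≤w₂ → ℕ.<⇒≱ lt (begin
      t ℕ.+ (d₁ ℕ.+ d₂)  ≡⟨ x∙yz≈y∙xz t d₁ d₂ ⟩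
      d₁ ℕ.+ (t ℕ.+ d₂)  ≤⟨ ℕ.+-mono-≤ (ℕ.≮⇒≥ w₁≮d₁) t+d₂≤w₂ ⟩
      w₁ ℕ.+ w₂          ∎)))
      where
      open ℕ.≤-Reasoning
      open import Algebra.Properties.CommutativeSemigroup ℕ.+-commutativeSemigroup using (x∙yz≈y∙xz)

  Degree≤-shift : ∀ {p w d} c → Degree≤ p w d → Degree≤ (shift c p) w d
  Degree≤-shift {[]}    c deg = Degree≤-[]
  Degree≤-shift {a ∷ p} c deg = Degree≤-add (Degree≤-∷ (Degree≤-head deg) Degree≤-[])
    (Degree≤-pred (Degree≤-mul (Degree≤-linear c) (Degree≤-shift c (Degree≤-tail deg))))

  Degree≤-backDiff : ∀ {p w d} c → Degree≤ p w d → Degree≤ (backDiff c p) w (suc d)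
  Degree≤-backDiff {[]}    c deg = Degree≤-[]
  Degree≤-backDiff {a ∷ p} c deg = Degree≤-add (Degree≤-∷ (λ _ → refl) (Degree≤-backDiff c (Degree≤-tail deg)))
    (Degree≤-scale c (Degree≤-shift (- c) (Degree≤-tail deg)))

  Degree≤-backDiff^ : ∀ {p w d} c a → Degree≤ p w d → Degree≤ (backDiff^ c a p) w (a ℕ.+ d)
  Degree≤-backDiff^ c zero    deg = deg
  Degree≤-backDiff^ c (suc a) deg = Degree≤-backDiff c (Degree≤-backDiff^ c a deg)

  sumP : ∀ {m} → (Fin m → Poly) → Poly
  sumP {zero}  f = []
  sumP {suc m} f = add (f zero) (sumP (f ∘ suc))

  detP : ∀ m → (Fin m → Fin m → Poly) → Poly
  detP zero    A = 1ℚ ∷ []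
  detP (suc m) A = sumP (λ j → scale (sign (toℕ j)) (mul (A zero j) (detP m (minor A j))))

  eval-sumP : ∀ {m} (f : Fin m → Poly) x → eval (sumP f) x ≡ sum (λ j → eval (f j) x)
  eval-sumP {zero}  f x = refl
  eval-sumP {suc m} f x = trans (eval-add (f zero) (sumP (f ∘ suc)) x) (cong (eval (f zero) x +_) (eval-sumP (f ∘ suc) x))

  eval-detP : ∀ m A x → eval (detP m A) x ≡ det m (λ i j → eval (A i j) x)
  eval-detP zero    A x = eval-one x
  eval-detP (suc m) A x = begin
    eval (detP (suc m) A) x
      ≡⟨ eval-sumP (λ j → scale (sign (toℕ j)) (mul (A zero j) (detP m (minor A j)))) x ⟩
    sum (λ j → eval (scale (sign (toℕ j)) (mul (A zero j) (detP m (minor A j)))) x)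
      ≡⟨ sum-cong-≗ (λ j → trans (eval-scale (sign (toℕ j)) (mul (A zero j) (detP m (minor A j))) x) (cong (sign (toℕ j) *_)
           (trans (eval-mul (A zero j) (detP m (minor A j)) x) (cong (eval (A zero j) x *_) (eval-detP m (minor A j) x))))) ⟩
    sum (λ j → sign (toℕ j) * (eval (A zero j) x * det m (λ i k → eval (minor A j i k) x)))
      ≡⟨ det-expand (λ i j → eval (A i j) x) ⟨
    det (suc m) (λ i j → eval (A i j) x) ∎
    where open ≡-Reasoning

  Degree≤-sumP : ∀ {m w d} (f : Fin m → Poly) → (∀ j → Degree≤ (f j) w d) → Degree≤ (sumP f) w d
  Degree≤-sumP {zero}  f deg = Degree≤-[]
  Degree≤-sumP {suc m} f deg = Degree≤-add (deg zero) (Degree≤-sumP (f ∘ suc) (deg ∘ suc))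

  Degree≤-detP : ∀ m (A : Fin m → Fin m → Poly) (w d : Fin m → ℕ) → (∀ i j → Degree≤ (A i j) (w j) (d i)) →
                 Degree≤ (detP m A) (ℕΣ.sum w) (ℕΣ.sum d)
  Degree≤-detP zero    A w d deg = Degree≤-const 1ℚ
  Degree≤-detP (suc m) A w d deg = Degree≤-sumP _ λ j → Degree≤-scale (sign (toℕ j))
    (subst (λ v → Degree≤ (mul (A zero j) (detP m (minor A j))) v (ℕΣ.sum d)) (sym (ℕΣ.sum-remove w))
      (Degree≤-mul (deg zero j) (Degree≤-detP m (minor A j) (w ∘ punchIn j) (d ∘ suc) (λ i k → deg (suc i) (punchIn j k)))))

  sumℕ-cong : ∀ N {f g : ℕ → ℚ} → (∀ t → f t ≡ g t) → sumℕ N f ≡ sumℕ N g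
  sumℕ-cong zero    f≡g = refl
  sumℕ-cong (suc N) f≡g = cong₂ _+_ (sumℕ-cong N f≡g) (f≡g N)

  sumℕ-zero : ∀ N (f : ℕ → ℚ) → (∀ t → f t ≡ 0ℚ) → sumℕ N f ≡ 0ℚ
  sumℕ-zero zero    f f≡0 = refl
  sumℕ-zero (suc N) f f≡0 = cong₂ _+_ (sumℕ-zero N f f≡0) (f≡0 N)

  sumℕ-suc : ∀ N (f : ℕ → ℚ) → sumℕ (suc N) f ≡ f 0 + sumℕ N (f ∘ suc)
  sumℕ-suc zero    f = solve 1 (λ a → con 0ℚ :+ a := a :+ con 0ℚ) refl (f 0)
  sumℕ-suc (suc N) f = trans (cong (_+ f (suc N)) (sumℕ-suc N f)) (+-assoc (f 0) (sumℕ N (f ∘ suc)) (f (suc N)))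

  *-distribˡ-sumℕ : ∀ N c (f : ℕ → ℚ) → c * sumℕ N f ≡ sumℕ N (λ t → c * f t)
  *-distribˡ-sumℕ zero    c f = *-zeroʳ c
  *-distribˡ-sumℕ (suc N) c f = trans (*-distribˡ-+ c (sumℕ N f) (f N)) (cong (_+ c * f N) (*-distribˡ-sumℕ N c f))

  eval-zero : ∀ p {x} → (∀ t → coeff p t ≡ 0ℚ) → eval p x ≡ 0ℚ
  eval-zero []      {x} p≡0 = refl
  eval-zero (c ∷ p) {x} p≡0 = trans (cong₂ (λ a e → a + x * e) (p≡0 zero) (eval-zero p (p≡0 ∘ suc)))
                                    (trans (cong (0ℚ +_) (*-zeroʳ x)) (+-identityˡ 0ℚ))

  eval-0 : ∀ p → eval p 0ℚ ≡ coeff p 0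
  eval-0 []      = refl
  eval-0 (c ∷ p) = trans (cong (c +_) (*-zeroˡ (eval p 0ℚ))) (+-identityʳ c)

  eval≡evalPoly : ∀ p d x → (∀ t → d ℕ.< t → coeff p t ≡ 0ℚ) → eval p x ≡ evalPoly (coeff p) d x
  eval≡evalPoly p d x high≡0 = eval-sumℕ p (suc d) (λ t d<t → high≡0 t d<t)
    where
    eval-sumℕ : ∀ p N → (∀ t → N ℕ.≤ t → coeff p t ≡ 0ℚ) → eval p x ≡ sumℕ N (λ t → coeff p t * x ^ℚ t)
    eval-sumℕ p       zero    high≡0 = eval-zero p (λ t → high≡0 t ℕ.z≤n)
    eval-sumℕ []      (suc N) _      = sym (sumℕ-zero (suc N) _ (λ t → *-zeroˡ (x ^ℚ t)))
    eval-sumℕ (c ∷ p) (suc N) high≡0 = begin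
      c + x * eval p x
        ≡⟨ cong (λ e → c + x * e) (eval-sumℕ p N (λ t N≤t → high≡0 (suc t) (ℕ.s≤s N≤t))) ⟩
      c + x * sumℕ N (λ t → coeff p t * x ^ℚ t)
        ≡⟨ cong₂ _+_ (sym (*-identityʳ c)) (*-distribˡ-sumℕ N x _) ⟩
      c * 1ℚ + sumℕ N (λ t → x * (coeff p t * x ^ℚ t))
        ≡⟨ cong (c * 1ℚ +_) (sumℕ-cong N (λ t → solve 3 (λ x a b → x :* (a :* b) := a :* (x :* b)) refl x (coeff p t) (x ^ℚ t))) ⟩
      c * 1ℚ + sumℕ N (λ t → coeff p t * (x * x ^ℚ t))
        ≡⟨ sumℕ-suc N (λ t → coeff (c ∷ p) t * x ^ℚ t) ⟨
      sumℕ (suc N) (λ t → coeff (c ∷ p) t * x ^ℚ t) ∎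
      where open ≡-Reasoning

  ^ℚ-inverse : ∀ {y M} → y * M ≡ 1ℚ → ∀ k → y ^ℚ k * M ^ℚ k ≡ 1ℚ
  ^ℚ-inverse yM≡1 zero    = refl
  ^ℚ-inverse {y} {M} yM≡1 (suc k) = begin
    (y * y ^ℚ k) * (M * M ^ℚ k)    ≡⟨ solve 4 (λ y a m b → (y :* a) :* (m :* b) := (y :* m) :* (a :* b)) refl y (y ^ℚ k) M (M ^ℚ k) ⟩
    (y * M) * (y ^ℚ k * M ^ℚ k)    ≡⟨ cong₂ _*_ yM≡1 (^ℚ-inverse {y} {M} yM≡1 k) ⟩
    1ℚ * 1ℚ                        ≡⟨⟩
    1ℚ                             ∎
    where open ≡-Reasoning

  evalPoly-reverse : ∀ {y M} → y * M ≡ 1ℚ → ∀ d (q : ℕ → ℚ) →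
                     y ^ℚ d * evalPoly q d M ≡ evalPoly (λ i → q (d ∸ i)) d y
  evalPoly-reverse yM≡1 zero    q = solve 1 (λ a → con 1ℚ :* (con 0ℚ :+ a :* con 1ℚ) := con 0ℚ :+ a :* con 1ℚ) refl (q 0)
  evalPoly-reverse {y} {M} yM≡1 (suc d) q = begin
    (y * y ^ℚ d) * (S + q (suc d) * M ^ℚ suc d)
      ≡⟨ solve 5 (λ y yᵈ s a mᵈ⁺¹ → (y :* yᵈ) :* (s :+ a :* mᵈ⁺¹) := y :* (yᵈ :* s) :+ a :* ((y :* yᵈ) :* mᵈ⁺¹)) refl
           y (y ^ℚ d) S (q (suc d)) (M ^ℚ suc d) ⟩
    y * (y ^ℚ d * S) + q (suc d) * (y ^ℚ suc d * M ^ℚ suc d)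
      ≡⟨ cong₂ (λ e u → y * e + q (suc d) * u) (evalPoly-reverse yM≡1 d q) (^ℚ-inverse {y} {M} yM≡1 (suc d)) ⟩
    y * evalPoly (λ i → q (d ∸ i)) d y + q (suc d) * 1ℚ
      ≡⟨ cong (_+ q (suc d) * 1ℚ) (*-distribˡ-sumℕ (suc d) y _) ⟩
    sumℕ (suc d) (λ i → y * (q (d ∸ i) * y ^ℚ i)) + q (suc d) * 1ℚ
      ≡⟨ cong (_+ q (suc d) * 1ℚ) (sumℕ-cong (suc d) (λ i →
           solve 3 (λ y a b → y :* (a :* b) := a :* (y :* b)) refl y (q (d ∸ i)) (y ^ℚ i))) ⟩
    sumℕ (suc d) (λ i → q (d ∸ i) * y ^ℚ suc i) + q (suc d) * 1ℚ
      ≡⟨ +-comm _ (q (suc d) * 1ℚ) ⟩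
    q (suc d) * 1ℚ + sumℕ (suc d) (λ i → q (d ∸ i) * y ^ℚ suc i)
      ≡⟨ sumℕ-suc (suc d) (λ i → q (suc d ∸ i) * y ^ℚ i) ⟨
    evalPoly (λ i → q (suc d ∸ i)) (suc d) y ∎
    where
    open ≡-Reasoning
    S : ℚ
    S = evalPoly q d M

module FallingFactorial where
  open import Data.Nat as ℕ using (ℕ; zero; suc; _∸_; _!)
  import Data.Nat.Properties as ℕ
  open import Data.Nat.Combinatorics.Base using (_P′_)
  open import Data.Nat.Combinatorics.Specification using (nP′k≡n!/[n∸k]!)
  open import Data.Nat.Divisibility using (m≤n⇒m!∣n!)
  open import Data.Nat.DivMod using (m/n*n≡m)
  open import Data.List using ([]; _∷_)
  open import Data.Rational using (0ℚ; 1ℚ; _+_; _*_; -_; _-_)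
  open import Data.Rational.Properties using (*-zeroʳ)
  open import Data.Rational.Solver using (module +-*-Solver)
  open +-*-Solver
  open import Relation.Nullary using (yes; no)
  open import Relation.Binary.PropositionalEquality
  open ≡-Reasoning
  open NatEmbedding
  open Polynomials

  fallingFactorial : ℕ → Poly
  fallingFactorial zero    = 1ℚ ∷ []
  fallingFactorial (suc e) = mul (- fromℕ e ∷ 1ℚ ∷ []) (fallingFactorial e)

  Degree≤-fallingFactorial : ∀ e → Degree≤ (fallingFactorial e) e 0
  Degree≤-fallingFactorial zero    = Degree≤-const 1ℚ
  Degree≤-fallingFactorial (suc e) = Degree≤-mul (Degree≤-linear (- fromℕ e)) (Degree≤-fallingFactorial e)

  k>n⇒nP′k≡0 : ∀ {n k} → n ℕ.< k → n P′ k ≡ 0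
  k>n⇒nP′k≡0 {n} {suc k} (ℕ.s≤s n≤k) rewrite ℕ.m≤n⇒m∸n≡0 n≤k = refl

  [n∸k]!*nP′k≡n! : ∀ {n k} → k ℕ.≤ n → (n ∸ k) ! ℕ.* (n P′ k) ≡ n !
  [n∸k]!*nP′k≡n! {n} {k} k≤n = begin
    (n ∸ k) ! ℕ.* (n P′ k)                 ≡⟨ cong ((n ∸ k) ! ℕ.*_) (nP′k≡n!/[n∸k]! k≤n) ⟩
    (n ∸ k) ! ℕ.* (n ! ℕ./ (n ∸ k) !)    ≡⟨ ℕ.*-comm ((n ∸ k) !) _ ⟩
    n ! ℕ./ (n ∸ k) ! ℕ.* (n ∸ k) !      ≡⟨ m/n*n≡m (m≤n⇒m!∣n! (ℕ.m∸n≤m n k)) ⟩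
    n !                                  ∎
    where instance _ = (n ∸ k) ℕ.!≢0

  eval-fallingFactorial : ∀ x e → eval (fallingFactorial e) (fromℕ x) ≡ fromℕ (x P′ e)
  eval-fallingFactorial x zero    = eval-one (fromℕ x)
  eval-fallingFactorial x (suc e) = begin
    eval (mul (- fromℕ e ∷ 1ℚ ∷ []) (fallingFactorial e)) (fromℕ x)
      ≡⟨ eval-mul (- fromℕ e ∷ 1ℚ ∷ []) (fallingFactorial e) (fromℕ x) ⟩
    (- fromℕ e + fromℕ x * (1ℚ + fromℕ x * 0ℚ)) * eval (fallingFactorial e) (fromℕ x)
      ≡⟨ cong₂ _*_ (solve 2 (λ e x → :- e :+ x :* (con 1ℚ :+ x :* con 0ℚ) := x :- e) refl (fromℕ e) (fromℕ x))
                   (eval-fallingFactorial x e) ⟩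
    (fromℕ x - fromℕ e) * fromℕ (x P′ e)
      ≡⟨ truncate ⟩
    fromℕ (x ∸ e) * fromℕ (x P′ e)
      ≡⟨ fromℕ-* (x ∸ e) (x P′ e) ⟨
    fromℕ (x P′ suc e) ∎
    where
    truncate : (fromℕ x - fromℕ e) * fromℕ (x P′ e) ≡ fromℕ (x ∸ e) * fromℕ (x P′ e)
    truncate with e ℕ.≤? x
    ... | yes e≤x = cong (_* fromℕ (x P′ e)) (sym (fromℕ-∸ x e e≤x))
    ... | no  e≰x rewrite k>n⇒nP′k≡0 (ℕ.≰⇒> e≰x) = trans (*-zeroʳ (fromℕ x - fromℕ e)) (sym (*-zeroʳ (fromℕ (x ∸ e))))

module DifferenceTable where
  open import Data.Nat as ℕ using (ℕ; zero; suc; _∸_; _⊓_; s≤s; z≤n)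
  import Data.Nat.Properties as ℕ
  open import Data.Fin as Fin using (Fin; toℕ; inject₁; fromℕ<)
  import Data.Fin.Properties as Fin
  open import Data.Rational using (ℚ; 1ℚ; _+_; _*_; _-_)
  open import Data.Rational.Solver using (module +-*-Solver)
  open +-*-Solver
  open import Function using (_∘_)
  open import Relation.Nullary using (yes; no; contradiction)
  open import Relation.Binary.PropositionalEquality
  open ≡-Reasoning
  open NatEmbedding
  open Determinant using (Matrix; det-cong; det-subtract-next-row)

  record DifferenceFamily (c : ℚ) (r : ℕ) : Set where
    field
      row     : ℕ → ℚ → Fin r → ℚ
      row-suc : ∀ a x j → row (suc a) x j ≡ row a x j - row a (x - c) j
  open DifferenceFamily

  height : ℕ → ℕ → ℕ
  height r t = r ∸ suc t

  rows : ∀ {c r} → DifferenceFamily c r → ℚ → (ℕ → ℕ) → Matrix r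
  rows {c} {r} D m h i = row D (h (toℕ i)) (m + c * fromℕ (height r (toℕ i)))

  det-rows-raise : ∀ {c r} (D : DifferenceFamily c r) m (h h′ : ℕ → ℕ) L → suc L ℕ.< r →
                   (∀ t → t ≢ L → h′ t ≡ h t) → h′ L ≡ suc (h L) → h (suc L) ≡ h L →
                   det r (rows D m h′) ≡ det r (rows D m h)
  det-rows-raise {c} {suc (suc k)} D m h h′ L (s≤s (s≤s L≤k)) h′≡h h′L≡1+hL hL+1≡hL =
    det-subtract-next-row i (rows D m h) (rows D m h′) other-rows row-L
    where
    i : Fin (suc k)
    i = fromℕ< (s≤s L≤k)

    toℕ-i : toℕ i ≡ L
    toℕ-i = Fin.toℕ-fromℕ< (s≤s L≤k)

    toℕ-inject₁-i : toℕ (inject₁ i) ≡ L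
    toℕ-inject₁-i = trans (Fin.toℕ-inject₁ i) toℕ-i

    other-rows : ∀ l → l ≢ inject₁ i → ∀ j → rows D m h′ l j ≡ rows D m h l j
    other-rows l l≢i j =
      cong (λ a → row D a _ j) (h′≡h (toℕ l) (λ l≡L → l≢i (Fin.toℕ-injective (trans l≡L (sym toℕ-inject₁-i)))))

    next-point : m + c * fromℕ (height (suc (suc k)) L) - c ≡ m + c * fromℕ (height (suc (suc k)) (suc L))
    next-point = begin
      m + c * fromℕ (suc k ∸ L) - c        ≡⟨ cong (λ a → m + c * fromℕ a - c) (ℕ.+-∸-assoc 1 L≤k) ⟩
      m + c * fromℕ (suc (k ∸ L)) - c      ≡⟨ cong (λ a → m + c * a - c) (fromℕ-+ 1 (k ∸ L)) ⟩
      m + c * (1ℚ + fromℕ (k ∸ L)) - c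
        ≡⟨ solve 3 (λ m c a → m :+ c :* (con 1ℚ :+ a) :- c := m :+ c :* a) refl m c (fromℕ (k ∸ L)) ⟩
      m + c * fromℕ (k ∸ L)                ∎

    row-L : ∀ j → rows D m h′ (inject₁ i) j ≡ rows D m h (inject₁ i) j - rows D m h (Fin.suc i) j
    row-L j rewrite toℕ-inject₁-i | toℕ-i | h′L≡1+hL | hL+1≡hL =
      trans (row-suc D (h L) _ j)
            (cong (λ x → row D (h L) (m + c * fromℕ (height (suc (suc k)) L)) j - row D (h L) x j) next-point)

  [_<_] : ℕ → ℕ → ℕ
  [ t     < zero  ] = 0
  [ zero  < suc L ] = 1
  [ suc t < suc L ] = [ t < L ]

  [<]-suc : ∀ {t L} → t ≢ L → [ t < suc L ] ≡ [ t < L ]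
  [<]-suc {zero}  {zero}  t≢L = contradiction refl t≢L
  [<]-suc {zero}  {suc L} t≢L = refl
  [<]-suc {suc t} {zero}  t≢L = refl
  [<]-suc {suc t} {suc L} t≢L = [<]-suc (t≢L ∘ cong suc)

  [<]-yes : ∀ {t L} → t ℕ.< L → [ t < L ] ≡ 1
  [<]-yes {zero}  {suc L} _         = refl
  [<]-yes {suc t} {suc L} (s≤s t<L) = [<]-yes t<L

  [<]-no : ∀ {t L} → L ℕ.≤ t → [ t < L ] ≡ 0
  [<]-no {t}     {zero}  _         = refl
  [<]-no {suc t} {suc L} (s≤s L≤t) = [<]-no L≤t

  det-rows-cong : ∀ {c r} (D : DifferenceFamily c r) m {h h′ : ℕ → ℕ} → (∀ t → h t ≡ h′ t) →
                  det r (rows D m h) ≡ det r (rows D m h′)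
  det-rows-cong D m h≡h′ = det-cong (λ i j → cong (λ a → row D a _ j) (h≡h′ (toℕ i)))

  -- Rows are raised from the top down, each against the row below it while that row is still unraised.
  det-rows-sweep : ∀ {c r} (D : DifferenceFamily c r) m (h : ℕ → ℕ) k L → L ℕ.< r → (∀ t → t ℕ.≤ L → h t ≡ k) →
                   det r (rows D m (λ t → h t ℕ.+ [ t < L ])) ≡ det r (rows D m h)
  det-rows-sweep D m h k zero    _      flat = det-rows-cong D m (λ t → ℕ.+-identityʳ (h t))
  det-rows-sweep D m h k (suc L) L+1<r flat = trans
    (det-rows-raise D m (raised L) (raised (suc L)) L L+1<r others row-L row-L+1)
    (det-rows-sweep D m h k L (ℕ.<-trans (ℕ.n<1+n L) L+1<r) (λ t t≤L → flat t (ℕ.m≤n⇒m≤1+n t≤L)))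
    where
    raised : ℕ → ℕ → ℕ
    raised L′ t = h t ℕ.+ [ t < L′ ]

    others : ∀ t → t ≢ L → raised (suc L) t ≡ raised L t
    others t t≢L = cong (h t ℕ.+_) ([<]-suc t≢L)

    row-L : raised (suc L) L ≡ suc (raised L L)
    row-L = begin
      h L ℕ.+ [ L < suc L ]  ≡⟨ cong (h L ℕ.+_) ([<]-yes (ℕ.n<1+n L)) ⟩
      h L ℕ.+ 1              ≡⟨ ℕ.+-suc (h L) 0 ⟩
      suc (h L ℕ.+ 0)        ≡⟨ cong (λ b → suc (h L ℕ.+ b)) ([<]-no {L} ℕ.≤-refl) ⟨
      suc (h L ℕ.+ [ L < L ]) ∎

    row-L+1 : raised L (suc L) ≡ raised L L
    row-L+1 = cong₂ ℕ._+_ (trans (flat (suc L) ℕ.≤-refl) (sym (flat L (ℕ.n≤1+n L))))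
                          (trans ([<]-no (ℕ.n≤1+n L)) (sym ([<]-no {L} ℕ.≤-refl)))

  det-rows-stage : ∀ {c r} (D : DifferenceFamily c r) m k → k ℕ.< r →
                   det r (rows D m (λ t → suc k ⊓ height r t)) ≡ det r (rows D m (λ t → k ⊓ height r t))
  det-rows-stage {r = r} D m k k<r = trans (det-rows-cong D m level-suc)
    (det-rows-sweep D m (λ t → k ⊓ height r t) k (r ∸ suc k) (ℕ.∸-monoʳ-< (s≤s z≤n) k<r) flat)
    where
    swap : ∀ {a b} → a ℕ.+ suc b ℕ.≤ r → b ℕ.≤ r ∸ suc a
    swap {a} {b} a+1+b≤r = ℕ.m+n≤o⇒m≤o∸n b (subst (ℕ._≤ r) a+1+b≡b+1+a a+1+b≤r)
      where
      a+1+b≡b+1+a : a ℕ.+ suc b ≡ b ℕ.+ suc a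
      a+1+b≡b+1+a = trans (ℕ.+-suc a b) (trans (cong suc (ℕ.+-comm a b)) (sym (ℕ.+-suc b a)))

    flat : ∀ t → t ℕ.≤ r ∸ suc k → k ⊓ height r t ≡ k
    flat t t≤L = ℕ.m≤n⇒m⊓n≡m (swap (ℕ.m≤o∸n⇒m+n≤o t k<r t≤L))

    level-suc : ∀ t → suc k ⊓ height r t ≡ k ⊓ height r t ℕ.+ [ t < r ∸ suc k ]
    level-suc t with t ℕ.<? r ∸ suc k
    ... | yes t<L = begin
      suc k ⊓ height r t           ≡⟨ ℕ.m≤n⇒m⊓n≡m k<height ⟩
      suc k                        ≡⟨ ℕ.+-comm 1 k ⟩
      k ℕ.+ 1                      ≡⟨ cong₂ ℕ._+_ (ℕ.m≤n⇒m⊓n≡m (ℕ.<⇒≤ k<height)) ([<]-yes t<L) ⟨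
      k ⊓ height r t ℕ.+ [ t < r ∸ suc k ] ∎
      where
      k<height : suc k ℕ.≤ height r t
      k<height = ℕ.m+n≤o⇒m≤o∸n (suc k) (subst (ℕ._≤ r) (ℕ.+-comm (suc t) (suc k)) (ℕ.m≤o∸n⇒m+n≤o (suc t) k<r t<L))
    ... | no t≮L = begin
      suc k ⊓ height r t           ≡⟨ ℕ.m≥n⇒m⊓n≡n (ℕ.m≤n⇒m≤1+n height≤k) ⟩
      height r t                   ≡⟨ ℕ.+-identityʳ _ ⟨
      height r t ℕ.+ 0             ≡⟨ cong₂ ℕ._+_ (ℕ.m≥n⇒m⊓n≡n height≤k) ([<]-no (ℕ.≮⇒≥ t≮L)) ⟨
      k ⊓ height r t ℕ.+ [ t < r ∸ suc k ] ∎
      where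
      height≤k : height r t ℕ.≤ k
      height≤k = ℕ.m≤n+o⇒m∸n≤o r (suc t) (ℕ.≤-trans (ℕ.m≤n+m∸n r (suc k))
                   (subst (suc k ℕ.+ (r ∸ suc k) ℕ.≤_) (cong suc (ℕ.+-comm k t)) (ℕ.+-monoʳ-≤ (suc k) (ℕ.≮⇒≥ t≮L))))

  -- After stage k of the induction, row t has order  k ⊓ height r t.
  det-rows-difference-table : ∀ {c r} (D : DifferenceFamily c r) m →
                              det r (rows D m (height r)) ≡ det r (rows D m (λ _ → 0))
  det-rows-difference-table {r = zero}   D m = refl
  det-rows-difference-table {r = suc r′} D m =
    trans (det-rows-cong D m (λ t → sym (ℕ.m≥n⇒m⊓n≡n (ℕ.m∸n≤m r′ t)))) (stages r′ (ℕ.n<1+n r′))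
    where
    stages : ∀ k → k ℕ.< suc r′ →
             det (suc r′) (rows D m (λ t → k ⊓ height (suc r′) t)) ≡ det (suc r′) (rows D m (λ _ → 0))
    stages zero    _     = refl
    stages (suc k) k+1<r = trans (det-rows-stage D m k k<r) (stages k k<r)
      where
      k<r : k ℕ.< suc r′
      k<r = ℕ.<-trans (ℕ.n<1+n k) k+1<r

module ReciprocalFactorialMatrix where
  open import Data.Nat as ℕ using (ℕ; zero; suc; _∸_; _!; NonZero)
  import Data.Nat.Properties as ℕ
  open import Data.Nat.Combinatorics.Base using (_P′_)
  open import Data.Nat.Combinatorics.Specification using (nP′n≡n!)
  open import Data.Nat.Solver using (module +-*-Solver)
  open +-*-Solver using () renaming (solve to solveℕ; _:+_ to _⊕_; _:*_ to _⊗_; _:=_ to _⊜_; con to conℕ)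
  open import Data.Fin as Fin using (Fin; toℕ)
  import Data.Fin.Properties as Fin
  open import Data.Rational using (ℚ; 0ℚ; 1ℚ; _+_; _*_)
  open import Data.Rational.Properties using (*-1-monoid; *-comm; +-identityˡ)
  open import Algebra.Properties.Monoid.Sum *-1-monoid using (sum-cong-≗) renaming (sum to product)
  open import Algebra.Properties.Monoid.Sum ℕ.*-1-monoid using () renaming (sum to productℕ)
  import Algebra.Properties.Semiring.Sum ℕ.+-*-semiring as ℕΣ
  open import Function using (_∘_)
  open import Relation.Binary.PropositionalEquality
  open ≡-Reasoning
  open NatEmbedding
  open FallingFactorial
  open Polynomials
  open Determinant using (det-cong; det-upper-triangular; det-scale-rows)
  open DifferenceTable using (DifferenceFamily; height; rows; det-rows-difference-table)

  gProduct : ℕ → ℕ → ℕ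
  gProduct n zero    = 1
  gProduct n (suc s) = gProduct n s ℕ.* g (suc s) n

  [2n]!*gProduct≡[2n+2s]! : ∀ n s → (2 ℕ.* n) ! ℕ.* gProduct n s ≡ (2 ℕ.* n ℕ.+ 2 ℕ.* s) !
  [2n]!*gProduct≡[2n+2s]! n zero = trans (ℕ.*-identityʳ _) (cong _! (sym (ℕ.+-identityʳ (2 ℕ.* n))))
  [2n]!*gProduct≡[2n+2s]! n (suc s) = begin
    (2 ℕ.* n) ! ℕ.* (gProduct n s ℕ.* g (suc s) n)     ≡⟨ ℕ.*-assoc ((2 ℕ.* n) !) (gProduct n s) _ ⟨
    (2 ℕ.* n) ! ℕ.* gProduct n s ℕ.* g (suc s) n       ≡⟨ cong (ℕ._* g (suc s) n) ([2n]!*gProduct≡[2n+2s]! n s) ⟩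
    x ! ℕ.* ((2 ℕ.* n ℕ.+ 2 ℕ.* suc s) ℕ.* (2 ℕ.* n ℕ.+ 2 ℕ.* suc s ∸ 1))
                                                       ≡⟨ cong (λ y → x ! ℕ.* (y ℕ.* (y ∸ 1))) x+2 ⟩
    x ! ℕ.* (suc (suc x) ℕ.* suc x)
      ≡⟨ solveℕ 2 (λ f x → f ⊗ ((conℕ 2 ⊕ x) ⊗ (conℕ 1 ⊕ x)) ⊜ (conℕ 2 ⊕ x) ⊗ ((conℕ 1 ⊕ x) ⊗ f)) refl (x !) x ⟩
    suc (suc x) !                                      ≡⟨ cong _! x+2 ⟨
    (2 ℕ.* n ℕ.+ 2 ℕ.* suc s) !                        ∎
    where
    x : ℕ
    x = 2 ℕ.* n ℕ.+ 2 ℕ.* s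
    x+2 : 2 ℕ.* n ℕ.+ 2 ℕ.* suc s ≡ suc (suc x)
    x+2 = solveℕ 2 (λ n s → conℕ 2 ⊗ n ⊕ conℕ 2 ⊗ (conℕ 1 ⊕ s) ⊜ conℕ 2 ⊕ (conℕ 2 ⊗ n ⊕ conℕ 2 ⊗ s)) refl n s

  prodG-suc : ∀ n m R → m ℕ.≤ R → prodG m n (suc R) ≡ prodG m n R ℕ.* gProduct n m
  prodG-suc n zero    R _   = refl
  prodG-suc n (suc m) R m<R = begin
    prodG m n (suc R) ℕ.* (g (suc m) n ℕ.^ (R ∸ m))
      ≡⟨ cong₂ ℕ._*_ (prodG-suc n m R (ℕ.<⇒≤ m<R)) (cong (g (suc m) n ℕ.^_) (ℕ.+-∸-assoc 1 m<R)) ⟩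
    prodG m n R ℕ.* gProduct n m ℕ.* (g (suc m) n ℕ.* g (suc m) n ℕ.^ (R ∸ suc m))
      ≡⟨ solveℕ 4 (λ p q a b → p ⊗ q ⊗ (a ⊗ b) ⊜ (p ⊗ b) ⊗ (q ⊗ a)) refl
           (prodG m n R) (gProduct n m) (g (suc m) n) (g (suc m) n ℕ.^ (R ∸ suc m)) ⟩
    prodG m n R ℕ.* (g (suc m) n ℕ.^ (R ∸ suc m)) ℕ.* (gProduct n m ℕ.* g (suc m) n) ∎

  prodG-last : ∀ n R → prodG R n R ≡ prodG (R ∸ 1) n R
  prodG-last n zero    = refl
  prodG-last n (suc R) rewrite ℕ.n∸n≡0 R = ℕ.*-identityʳ _

  prodG≡product : ∀ n r → fromℕ (prodG (r ∸ 1) n r) ≡ product (λ (i : Fin r) → fromℕ (gProduct n (height r (toℕ i))))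
  prodG≡product n zero    = refl
  prodG≡product n (suc R) = begin
    fromℕ (prodG R n (suc R))                          ≡⟨ cong fromℕ (prodG-suc n R R ℕ.≤-refl) ⟩
    fromℕ (prodG R n R ℕ.* gProduct n R)               ≡⟨ fromℕ-* (prodG R n R) (gProduct n R) ⟩
    fromℕ (prodG R n R) * fromℕ (gProduct n R)         ≡⟨ cong (λ p → fromℕ p * fromℕ (gProduct n R)) (prodG-last n R) ⟩
    fromℕ (prodG (R ∸ 1) n R) * fromℕ (gProduct n R)   ≡⟨ cong (_* fromℕ (gProduct n R)) (prodG≡product n R) ⟩
    product {R} (λ i → fromℕ (gProduct n (height R (toℕ i)))) * fromℕ (gProduct n R)
      ≡⟨ *-comm (product {R} (λ i → fromℕ (gProduct n (height R (toℕ i))))) (fromℕ (gProduct n R)) ⟩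
    product {suc R} (λ i → fromℕ (gProduct n (height (suc R) (toℕ i)))) ∎

  index-identity : ∀ {r n a b} → a ℕ.≤ n → a ℕ.< r → b ℕ.< r → (n ℕ.+ b) ∸ a ℕ.+ height r b ≡ n ℕ.+ height r a
  index-identity {r} {n} {a} {b} a≤n a<r b<r = ℕ.+-cancelʳ-≡ (a ℕ.+ suc b) _ _ (begin
    (u ℕ.+ v) ℕ.+ (a ℕ.+ suc b)
      ≡⟨ solveℕ 4 (λ u v a b → (u ⊕ v) ⊕ (a ⊕ b) ⊜ (u ⊕ a) ⊕ (v ⊕ b)) refl u v a (suc b) ⟩
    (u ℕ.+ a) ℕ.+ (v ℕ.+ suc b)
      ≡⟨ cong₂ ℕ._+_ (ℕ.m∸n+n≡m (ℕ.≤-trans a≤n (ℕ.m≤m+n n b))) (ℕ.m∸n+n≡m b<r) ⟩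
    (n ℕ.+ b) ℕ.+ r
      ≡⟨ cong ((n ℕ.+ b) ℕ.+_) (ℕ.m∸n+n≡m a<r) ⟨
    (n ℕ.+ b) ℕ.+ (w ℕ.+ suc a)
      ≡⟨ solveℕ 4 (λ n b w a → (n ⊕ b) ⊕ (w ⊕ (conℕ 1 ⊕ a)) ⊜ (n ⊕ w) ⊕ (a ⊕ (conℕ 1 ⊕ b))) refl n b w a ⟩
    (n ℕ.+ w) ℕ.+ (a ℕ.+ suc b) ∎)
    where
    u v w : ℕ
    u = (n ℕ.+ b) ∸ a
    v = height r b
    w = height r a

  two : ℚ
  two = fromℕ 2

  entry-scaled : ∀ {r n} → r ℕ.< n → (i j : Fin r) →
                 fromℕ (gProduct n (height r (toℕ i))) * entry n i j
                   ≡ eval (fallingFactorial (2 ℕ.* height r (toℕ j))) (fromℕ (2 ℕ.* n) + two * fromℕ (height r (toℕ i)))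
  entry-scaled {r} {n} r<n i j = begin
    fromℕ G * entry n i j             ≡⟨ *-comm (fromℕ G) (entry n i j) ⟩
    entry n i j * fromℕ G             ≡⟨ a/b*c≡d ((2 ℕ.* n) !) (K !) {{K ℕ.!≢0}} G (x P′ e) [2n]!*G≡xP′e*K! ⟩
    fromℕ (x P′ e)                    ≡⟨ eval-fallingFactorial x e ⟨
    eval (fallingFactorial e) (fromℕ x)
      ≡⟨ cong (eval (fallingFactorial e)) (trans (fromℕ-+ (2 ℕ.* n) (2 ℕ.* hᵢ)) (cong (fromℕ (2 ℕ.* n) +_) (fromℕ-* 2 hᵢ))) ⟩
    eval (fallingFactorial e) (fromℕ (2 ℕ.* n) + two * fromℕ hᵢ) ∎
    where
    hᵢ G K x e : ℕ
    hᵢ = height r (toℕ i)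
    G = gProduct n hᵢ
    K = 2 ℕ.* ((n ℕ.+ toℕ j) ∸ toℕ i)
    x = 2 ℕ.* n ℕ.+ 2 ℕ.* hᵢ
    e = 2 ℕ.* height r (toℕ j)

    K+e≡x : K ℕ.+ e ≡ x
    K+e≡x = trans (sym (ℕ.*-distribˡ-+ 2 ((n ℕ.+ toℕ j) ∸ toℕ i) (height r (toℕ j))))
      (trans (cong (2 ℕ.*_) (index-identity (ℕ.<⇒≤ (ℕ.<-trans (Fin.toℕ<n i) r<n)) (Fin.toℕ<n i) (Fin.toℕ<n j)))
             (ℕ.*-distribˡ-+ 2 n hᵢ))

    [2n]!*G≡xP′e*K! : (2 ℕ.* n) ! ℕ.* G ≡ (x P′ e) ℕ.* K !
    [2n]!*G≡xP′e*K! = begin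
      (2 ℕ.* n) ! ℕ.* G          ≡⟨ [2n]!*gProduct≡[2n+2s]! n hᵢ ⟩
      x !                        ≡⟨ [n∸k]!*nP′k≡n! (subst (e ℕ.≤_) K+e≡x (ℕ.m≤n+m e K)) ⟨
      (x ∸ e) ! ℕ.* (x P′ e)     ≡⟨ cong (λ y → y ! ℕ.* (x P′ e)) (trans (cong (_∸ e) (sym K+e≡x)) (ℕ.m+n∸n≡m K e)) ⟩
      K ! ℕ.* (x P′ e)           ≡⟨ ℕ.*-comm (K !) (x P′ e) ⟩
      (x P′ e) ℕ.* K !           ∎

  differenceEntry : ∀ r → ℕ → Fin r → Poly
  differenceEntry r a j = backDiff^ two a (fallingFactorial (2 ℕ.* height r (toℕ j)))

  differenceFamily : ∀ r → DifferenceFamily two r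
  differenceFamily r = record
    { row     = λ a x j → eval (differenceEntry r a j) x
    ; row-suc = λ a x j → eval-backDiff two (differenceEntry r a j) x
    }

  Q-entry : ∀ r → Fin r → Fin r → Poly
  Q-entry r i j = shift (two * fromℕ (height r (toℕ i))) (differenceEntry r (height r (toℕ i)) j)

  Q : ℕ → Poly
  Q r = detP r (Q-entry r)

  eval-Q : ∀ r m → eval (Q r) m ≡
                   det r (λ i j → eval (fallingFactorial (2 ℕ.* height r (toℕ j))) (m + two * fromℕ (height r (toℕ i))))
  eval-Q r m = begin
    eval (Q r) m                                    ≡⟨ eval-detP r (Q-entry r) m ⟩
    det r (λ i j → eval (Q-entry r i j) m)          ≡⟨ det-cong {r} (λ i j → eval-shift (c i) (differenceEntry r (h i) j) m) ⟩
    det r (rows (differenceFamily r) m (height r))  ≡⟨ det-rows-difference-table (differenceFamily r) m ⟩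
    det r (rows (differenceFamily r) m (λ _ → 0))   ∎
    where
    h : Fin r → ℕ
    h i = height r (toℕ i)
    c : Fin r → ℚ
    c i = two * fromℕ (h i)

  heightSum : ℕ → ℕ
  heightSum r = ℕΣ.sum (λ (i : Fin r) → height r (toℕ i))

  2*heightSum≡r*[r∸1] : ∀ r → 2 ℕ.* heightSum r ≡ r ℕ.* (r ∸ 1)
  2*heightSum≡r*[r∸1] zero          = refl
  2*heightSum≡r*[r∸1] (suc zero)    = refl
  2*heightSum≡r*[r∸1] (suc (suc R)) = begin
    2 ℕ.* (suc R ℕ.+ heightSum (suc R))           ≡⟨ ℕ.*-distribˡ-+ 2 (suc R) (heightSum (suc R)) ⟩
    2 ℕ.* suc R ℕ.+ 2 ℕ.* heightSum (suc R)       ≡⟨ cong (2 ℕ.* suc R ℕ.+_) (2*heightSum≡r*[r∸1] (suc R)) ⟩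
    2 ℕ.* suc R ℕ.+ suc R ℕ.* R
      ≡⟨ solveℕ 1 (λ R → conℕ 2 ⊗ (conℕ 1 ⊕ R) ⊕ (conℕ 1 ⊕ R) ⊗ R ⊜ (conℕ 2 ⊕ R) ⊗ (conℕ 1 ⊕ R)) refl R ⟩
    suc (suc R) ℕ.* suc R                         ∎

  Q-coeff-vanishes : ∀ r t → heightSum r ℕ.< t → coeff (Q r) t ≡ 0ℚ
  Q-coeff-vanishes r t T<t =
    vanishes Q-degree t (subst (ℕ._< t ℕ.+ T) (cong (T ℕ.+_) (sym (ℕ.+-identityʳ T))) (ℕ.+-monoˡ-< T T<t))
    where
    T : ℕ
    T = heightSum r
    Q-degree : Degree≤ (Q r) (2 ℕ.* T) T
    Q-degree = subst (λ w → Degree≤ (Q r) w T) (sym (ℕΣ.*-distribˡ-sum {r} 2 (λ i → height r (toℕ i))))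
      (Degree≤-detP r (Q-entry r) (λ j → 2 ℕ.* height r (toℕ j)) (λ i → height r (toℕ i)) (λ i j →
        Degree≤-shift _ (subst (Degree≤ _ (2 ℕ.* height r (toℕ j))) (ℕ.+-identityʳ _)
          (Degree≤-backDiff^ two (height r (toℕ i)) (Degree≤-fallingFactorial (2 ℕ.* height r (toℕ j)))))))

  fromℕ-product : ∀ {m} (f : Fin m → ℕ) → product (λ i → fromℕ (f i)) ≡ fromℕ (productℕ f)
  fromℕ-product {zero}  f = refl
  fromℕ-product {suc m} f = trans (cong (fromℕ (f Fin.zero) *_) (fromℕ-product (f ∘ Fin.suc))) (sym (fromℕ-* (f Fin.zero) _))

  productℕ-nonZero : ∀ {m} (f : Fin m → ℕ) → (∀ i → NonZero (f i)) → NonZero (productℕ f)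
  productℕ-nonZero {zero}  f f≢0 = _
  productℕ-nonZero {suc m} f f≢0 = ℕ.m*n≢0 (f Fin.zero) _ {{f≢0 Fin.zero}} {{productℕ-nonZero (f ∘ Fin.suc) (f≢0 ∘ Fin.suc)}}

  -- At m = 0 the matrix  (2hᵢ)^{(2hⱼ)}  is upper triangular with diagonal  (2hᵢ)!.
  Q-at-0≢0 : ∀ r → eval (Q r) 0ℚ ≢ 0ℚ
  Q-at-0≢0 r = subst (_≢ 0ℚ) (sym eval-Q-at-0)
    (fromℕ≢0 _ {{productℕ-nonZero (λ i → (2 ℕ.* h i) !) (λ i → (2 ℕ.* h i) ℕ.!≢0)}})
    where
    h : Fin r → ℕ
    h i = height r (toℕ i)

    lower≡0 : ∀ i j → toℕ j ℕ.< toℕ i → fromℕ ((2 ℕ.* h i) P′ (2 ℕ.* h j)) ≡ 0ℚ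
    lower≡0 i j j<i = cong fromℕ (k>n⇒nP′k≡0 (ℕ.*-monoʳ-< 2 (ℕ.∸-monoʳ-< (ℕ.s≤s j<i) (Fin.toℕ<n i))))

    eval-Q-at-0 : eval (Q r) 0ℚ ≡ fromℕ (productℕ (λ i → (2 ℕ.* h i) !))
    eval-Q-at-0 = begin
      eval (Q r) 0ℚ
        ≡⟨ eval-Q r 0ℚ ⟩
      det r (λ i j → eval (fallingFactorial (2 ℕ.* h j)) (0ℚ + two * fromℕ (h i)))
        ≡⟨ det-cong (λ i j → trans (cong (eval (fallingFactorial (2 ℕ.* h j))) (trans (+-identityˡ _) (sym (fromℕ-* 2 (h i)))))
                                   (eval-fallingFactorial (2 ℕ.* h i) (2 ℕ.* h j))) ⟩
      det r (λ i j → fromℕ ((2 ℕ.* h i) P′ (2 ℕ.* h j)))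
        ≡⟨ det-upper-triangular _ lower≡0 ⟩
      product (λ i → fromℕ ((2 ℕ.* h i) P′ (2 ℕ.* h i)))
        ≡⟨ sum-cong-≗ (λ i → cong fromℕ (nP′n≡n! (2 ℕ.* h i))) ⟩
      product (λ i → fromℕ ((2 ℕ.* h i) !))
        ≡⟨ fromℕ-product (λ i → (2 ℕ.* h i) !) ⟩
      fromℕ (productℕ (λ i → (2 ℕ.* h i) !)) ∎

  Δbar≡eval-Q : ∀ r n → r ℕ.< n → Δbar n r ≡ inv2n n ^ℚ (r ℕ.* (r ∸ 1)) * eval (Q r) (fromℕ (2 ℕ.* n))
  Δbar≡eval-Q r n r<n = cong (inv2n n ^ℚ (r ℕ.* (r ∸ 1)) *_) (begin
    fromℕ (prodG (r ∸ 1) n r) * det r (entry n)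
      ≡⟨ cong (_* det r (entry n)) (prodG≡product n r) ⟩
    product c * det r (entry n)
      ≡⟨ det-scale-rows c (entry n) ⟨
    det r (λ i j → c i * entry n i j)
      ≡⟨ det-cong {r} (entry-scaled r<n) ⟩
    det r (λ i j → eval (fallingFactorial (2 ℕ.* height r (toℕ j))) (fromℕ (2 ℕ.* n) + two * fromℕ (height r (toℕ i))))
      ≡⟨ eval-Q r (fromℕ (2 ℕ.* n)) ⟨
    eval (Q r) (fromℕ (2 ℕ.* n)) ∎)
    where
    c : Fin r → ℚ
    c i = fromℕ (gProduct n (height r (toℕ i)))

  inv2n*2n≡1 : ∀ n .{{_ : NonZero n}} → inv2n n * fromℕ (2 ℕ.* n) ≡ 1ℚ
  inv2n*2n≡1 (suc n) = a/b*c≡d 1 (2 ℕ.* suc n) (2 ℕ.* suc n) 1 refl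

open import Data.Nat using (ℕ; suc; _+_; _*_; _∸_; _≤_; _<_; z≤n; NonZero; >-nonZero)
import Data.Nat.Properties as ℕ
open import Data.Nat.DivMod using (_/_; m*n/n≡m)
open import Data.Rational as ℚ using (ℚ; 0ℚ)
open import Data.Product using (∃; _×_; _,_)
open import Relation.Binary.PropositionalEquality using (_≡_; _≢_; cong; sym; trans; subst; module ≡-Reasoning)
open NatEmbedding using (fromℕ)
open Polynomials using (eval; coeff; eval-0; eval≡evalPoly; evalPoly-reverse)
open ReciprocalFactorialMatrix

lemma6p5 : (r : ℕ) → 1 ≤ r →
    ∃ λ (δ : ℕ → ℚ) →
      (δ (r * (r ∸ 1)) ≢ 0ℚ)
      × (∀ (n : ℕ) → r < n → Δbar n r ≡ evalPoly δ (r * (r ∸ 1)) (inv2n n))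
      × (∀ (i : ℕ) → i < (r * (r ∸ 1)) / 2 → δ i ≡ 0ℚ)
lemma6p5 r _ = δ , leading≢0 , Δbar≡P , low≡0
  where
  d T : ℕ
  d = r * (r ∸ 1)
  T = heightSum r

  δ : ℕ → ℚ
  δ i = coeff (Q r) (d ∸ i)

  d≡T+T : d ≡ T + T
  d≡T+T = trans (sym (2*heightSum≡r*[r∸1] r)) (cong (T +_) (ℕ.+-identityʳ T))

  leading≢0 : δ d ≢ 0ℚ
  leading≢0 = subst (_≢ 0ℚ) (trans (eval-0 (Q r)) (cong (coeff (Q r)) (sym (ℕ.n∸n≡0 d)))) (Q-at-0≢0 r)

  Δbar≡P : ∀ n → r < n → Δbar n r ≡ evalPoly δ d (inv2n n)
  Δbar≡P n r<n = begin
    Δbar n r                                    ≡⟨ Δbar≡eval-Q r n r<n ⟩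
    inv2n n ^ℚ d ℚ.* eval (Q r) M               ≡⟨ cong (inv2n n ^ℚ d ℚ.*_) (eval≡evalPoly (Q r) d M high≡0) ⟩
    inv2n n ^ℚ d ℚ.* evalPoly (coeff (Q r)) d M ≡⟨ evalPoly-reverse (inv2n*2n≡1 n {{n≢0}}) d (coeff (Q r)) ⟩
    evalPoly δ d (inv2n n)                      ∎
    where
    open ≡-Reasoning
    M : ℚ
    M = fromℕ (2 * n)
    n≢0 : NonZero n
    n≢0 = >-nonZero (ℕ.≤-<-trans z≤n r<n)
    high≡0 : ∀ t → d < t → coeff (Q r) t ≡ 0ℚ
    high≡0 t d<t = Q-coeff-vanishes r t (ℕ.≤-<-trans (subst (T ≤_) (sym d≡T+T) (ℕ.m≤m+n T T)) d<t)

  low≡0 : ∀ i → i < d / 2 → δ i ≡ 0ℚ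
  low≡0 i i<d/2 = Q-coeff-vanishes r (d ∸ i) (ℕ.m+n≤o⇒m≤o∸n (suc T) (subst (suc T + i ≤_) (sym d≡T+T) (ℕ.+-monoʳ-< T i<T)))
    where
    d/2≡T : d / 2 ≡ T
    d/2≡T = trans (cong (_/ 2) (trans (sym (2*heightSum≡r*[r∸1] r)) (ℕ.*-comm 2 T))) (m*n/n≡m T 2)
    i<T : i < T
    i<T = subst (i <_) d/2≡T i<d/2
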